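{- Let $n\ge 1$ and let $x$ be an indeterminate. Let $\mathscr{M}$ be the $n\times n$ matrix with entries $\mathscr{M}[i,j]=\mathscr{C}_{i+j-2}+x\,\mathscr{C}_{i+j-1}$ for $1\le i,j\le n$, where $\mathscr{C}_m=\frac{1}{m+1}\binom{2m}{m}$ is the $m$-th Catalan number. For integers $k,i\ge 1$ define \[ F(k,i)=\frac{1}{i(2i-1)}\binom{2i}{i-k}\sum_{0\le r\le k}\frac{1}{2k-r}\binom{2k-r}{r}\Big(ri+2ik^2-ik-2rk^2+2k^3-k^2\Big)x^r, \] and for integers $k\ge 0$ define \[ g(k)=\sum_{0\le r\le k}\binom{2k-r}{r}x^r . \] Then $F(k,k)=g(k)$ for $k\ge1$, and, defining the $n\times n$ matrices $L$ and $U$ (with entries rational functions of $x$) by \[ L[i,k]=\frac{F(k,i)}{g(k)},\qquad U[k,j]=\frac{F(k,j)}{g(k-1)}\qquad(1\le i,j,k\le n), \] $L$ is lower triangular with all diagonal entries equal to $1$, $U$ is upper triangular, and $LU=\mathscr{M}$; that is, $(L,U)$ is the LU-decomposition of $\mathscr{M}$.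
   Context: Binomial coefficients $\binom{a}{b}$ with integers $a\ge0$ and $b<0$ are taken to be $0$ (so $F(k,i)=0$ whenever $k>i$). The identity $LU=\mathscr{M}$ is an identity of rational functions in $x$ (equivalently, it holds for every value of $x$ at which all $g(k)$, $0\le k\le n$, are nonzero). -}

module Defs where

open import Data.Nat as ℕ using (ℕ; zero; suc; _≤ᵇ_)
open import Data.Nat.Combinatorics using (_C_)
open import Data.Integer as ℤ using (ℤ; +_; -[1+_])
open import Data.Rational as ℚ using (ℚ; 0ℚ; 1ℚ; _+_; _*_; _-_; _/_; 1/_; ≢-nonZero)
open import Data.Rational.Properties using (_≟_)
open import Data.Fin using (Fin; toℕ)
open import Relation.Nullary using (yes; no)
open import Relation.Binary.PropositionalEquality using (_≡_)
open import Data.Product using (_×_)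

ℕ→ℚ : ℕ → ℚ
ℕ→ℚ m = (+ m) / 1

binomℤ : ℕ → ℤ → ℕ
binomℤ a (+ b)     = a C b
binomℤ a -[1+ _ ]  = 0

infixr 8 _^_
_^_ : ℚ → ℕ → ℚ
x ^ zero  = 1ℚ
x ^ suc r = x * (x ^ r)

sumTo : ℕ → (ℕ → ℚ) → ℚ
sumTo zero    f = f 0
sumTo (suc k) f = sumTo k f + f (suc k)

sumFin : (n : ℕ) → (Fin n → ℚ) → ℚ
sumFin zero    f = 0ℚ
sumFin (suc n) f = f Fin.zero + sumFin n (λ i → f (Fin.suc i))

-- total inverse on ℚ (0 ↦ 0); only used at nonzero arguments
inv : ℚ → ℚ
inv q with q ≟ 0ℚ
... | yes _  = 0ℚ
... | no q≢0 = 1/_ q {{≢-nonZero q≢0}}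

catalan : ℕ → ℚ
catalan m = (+ ((2 ℕ.* m) C m)) / suc m

g : ℕ → ℚ → ℚ
g k x = sumTo k (λ r → ℕ→ℚ ((2 ℕ.* k ℕ.∸ r) C r) * x ^ r)

-- F(k,i) for k,i ≥ 1 (the value at k = 0 or i = 0 is irrelevant junk 0).
-- With K = suc k, I = suc i:
-- F(K,I) = 1/(I(2I-1)) binom(2I, I-K)
--          Σ_{0≤r≤K} 1/(2K-r) binom(2K-r, r)
--                 (rI + 2IK² - IK - 2rK² + 2K³ - K²) x^r
-- Here I(2I-1) is written suc i * suc (2 * i) and, for r ≤ K,
-- 2K - r is written K + (K ∸ r) (equal since r ≤ K).
F : ℕ → ℕ → ℚ → ℚ
F zero    _       x = 0ℚ
F (suc k) zero    x = 0ℚ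
F (suc k) (suc i) x =
  ((+ 1) / (suc i ℕ.* suc (2 ℕ.* i)))
  * ℕ→ℚ (binomℤ (2 ℕ.* I) (+ I ℤ.- + K))
  * sumTo K term
  where
  K I : ℕ
  K = suc k
  I = suc i
  Kq Iq : ℚ
  Kq = ℕ→ℚ K
  Iq = ℕ→ℚ I
  term : ℕ → ℚ
  term r =
    ((+ 1) / (K ℕ.+ (K ℕ.∸ r)))
    * ℕ→ℚ ((2 ℕ.* K ℕ.∸ r) C r)
    * ( ℕ→ℚ r * Iq + ℕ→ℚ 2 * Iq * Kq * Kq - Iq * Kq
        - ℕ→ℚ 2 * ℕ→ℚ r * Kq * Kq + ℕ→ℚ 2 * Kq * Kq * Kq - Kq * Kq )
    * x ^ r

-- The n×n matrices, indices 1..n represented by Fin n (index a ↦ a+1).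
-- 𝓜[i,j] = C_{i+j-2} + x C_{i+j-1}
𝓜 : (n : ℕ) → ℚ → Fin n → Fin n → ℚ
𝓜 n x a b = catalan (toℕ a ℕ.+ toℕ b) + x * catalan (suc (toℕ a ℕ.+ toℕ b))

Lmat : (n : ℕ) → ℚ → Fin n → Fin n → ℚ
Lmat n x a c = F (suc (toℕ c)) (suc (toℕ a)) x * inv (g (suc (toℕ c)) x)

Umat : (n : ℕ) → ℚ → Fin n → Fin n → ℚ
Umat n x c b = F (suc (toℕ c)) (suc (toℕ b)) x * inv (g (toℕ c) x)

matMul : (n : ℕ) → (Fin n → Fin n → ℚ) → (Fin n → Fin n → ℚ) → Fin n → Fin n → ℚ
matMul n A B a b = sumFin n (λ c → A a c * B c b)

LowerUnitriangular : (n : ℕ) → (Fin n → Fin n → ℚ) → Set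
LowerUnitriangular n A =
  (∀ a b → toℕ a ℕ.< toℕ b → A a b ≡ 0ℚ) × (∀ a → A a a ≡ 1ℚ)

UpperTriangular : (n : ℕ) → (Fin n → Fin n → ℚ) → Set
UpperTriangular n A = ∀ a b → toℕ b ℕ.< toℕ a → A a b ≡ 0ℚ

{-# OPTIONS --safe #-}
-- Let b(i,k) = C(2i,i-k) - C(2i,i-k-1) be the ballot numbers and b'(i,k) their
-- analogues for the odd rows 2i+1.  Rewriting the sum defining F with the two
-- ratio identities between neighbouring binomial coefficients gives the closed form
--   F(k+1,i+1) = b(i,k) g(k+1) + x b(i,k+1) g(k),
-- so F vanishes above the diagonal and F(k,k) = g(k).  In
--   (LU)[a,b] = Σ_c F(c+1,a+1) F(c+1,b+1) / (g(c+1) g(c))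
-- each term splits into b(a,c) b(b,c) + x b'(a,c) b'(b,c) plus a correction that
-- telescopes, because g(k) is a Fibonacci polynomial and satisfies
-- g(k+2) + x² g(k) = (1+2x) g(k+1).  What is left are the Hankel identities
-- Σ_c b(a,c) b(b,c) = C_{a+b} and Σ_c b'(a,c) b'(b,c) = C_{a+b+1}, which follow by
-- summation by parts from Pascal's rule b'(i,c) = b(i,c) + b(i,c+1),
-- b(i+1,c) = b'(i,c-1) + b'(i,c).
module Submission where

open import Defs
open import Data.Nat using (ℕ; _≤_)
open import Data.Rational using (ℚ; 0ℚ)
open import Data.Fin using (Fin)
open import Data.Product using (_×_)
open import Relation.Binary.PropositionalEquality using (_≡_; _≢_)

open import Data.Nat as ℕ using (zero; suc; z≤n; s≤s; _<_; _≤?_)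
import Data.Nat.Properties as ℕP
open import Data.Nat.Combinatorics
  using (_C_; nCk+nC[k+1]≡[n+1]C[k+1]; k>n⇒nCk≡0; nCk≡nC[n∸k]; nCn≡1; nC1≡n)
open import Data.Nat.Tactic.RingSolver using (solve-∀)
open import Data.Integer as ℤ using (+_)
import Data.Integer.Properties as ℤP
open import Data.Rational as ℚ using (1ℚ; _+_; _*_; _-_; -_; _/_; fromℚᵘ)
import Data.Rational.Properties as ℚP
open import Data.Rational.Unnormalised as ℚᵘ using (mkℚᵘ; *≡*)
import Data.Rational.Unnormalised.Properties as ℚᵘP
open import Data.Rational.Solver using (module +-*-Solver)
open import Data.Fin using (toℕ)
import Data.Fin.Properties as FinP
open import Data.Product using (_,_)
open import Data.Empty using (⊥-elim)
open import Relation.Nullary using (yes; no)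
open import Relation.Binary.PropositionalEquality
  using (refl; sym; trans; cong; cong₂; subst; subst₂; module ≡-Reasoning)
open ≡-Reasoning
open +-*-Solver

fromℚᵘ-homo-+ : ∀ p q → fromℚᵘ (p ℚᵘ.+ q) ≡ fromℚᵘ p + fromℚᵘ q
fromℚᵘ-homo-+ p q = ℚP.toℚᵘ-injective (ℚᵘP.≃-trans (ℚP.toℚᵘ-fromℚᵘ (p ℚᵘ.+ q))
  (ℚᵘP.≃-sym (ℚᵘP.≃-trans (ℚP.toℚᵘ-homo-+ (fromℚᵘ p) (fromℚᵘ q))
                          (ℚᵘP.+-cong (ℚP.toℚᵘ-fromℚᵘ p) (ℚP.toℚᵘ-fromℚᵘ q)))))

fromℚᵘ-homo-* : ∀ p q → fromℚᵘ (p ℚᵘ.* q) ≡ fromℚᵘ p * fromℚᵘ q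
fromℚᵘ-homo-* p q = ℚP.toℚᵘ-injective (ℚᵘP.≃-trans (ℚP.toℚᵘ-fromℚᵘ (p ℚᵘ.* q))
  (ℚᵘP.≃-sym (ℚᵘP.≃-trans (ℚP.toℚᵘ-homo-* (fromℚᵘ p) (fromℚᵘ q))
                          (ℚᵘP.*-cong (ℚP.toℚᵘ-fromℚᵘ p) (ℚP.toℚᵘ-fromℚᵘ q)))))

-- ℕ→ℚ m and (+ m) / suc n are by definition fromℚᵘ of unnormalised fractions,
-- so each identity below is a cross-multiplication in ℤ.
ℕ→ℚ-homo-+ : ∀ m n → ℕ→ℚ (m ℕ.+ n) ≡ ℕ→ℚ m + ℕ→ℚ n
ℕ→ℚ-homo-+ m n =
  trans (ℚP.fromℚᵘ-cong {mkℚᵘ (+ (m ℕ.+ n)) 0} {p ℚᵘ.+ q} (*≡* eq)) (fromℚᵘ-homo-+ p q)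
  where
  p = mkℚᵘ (+ m) 0
  q = mkℚᵘ (+ n) 0
  eq : + (m ℕ.+ n) ℤ.* + 1 ≡ (+ m ℤ.* + 1 ℤ.+ + n ℤ.* + 1) ℤ.* + 1
  eq = cong (ℤ._* + 1) (sym (cong₂ ℤ._+_ (ℤP.*-identityʳ (+ m)) (ℤP.*-identityʳ (+ n))))

ℕ→ℚ-homo-* : ∀ m n → ℕ→ℚ (m ℕ.* n) ≡ ℕ→ℚ m * ℕ→ℚ n
ℕ→ℚ-homo-* m n =
  trans (ℚP.fromℚᵘ-cong {mkℚᵘ (+ (m ℕ.* n)) 0} {p ℚᵘ.* q} (*≡* eq)) (fromℚᵘ-homo-* p q)
  where
  p = mkℚᵘ (+ m) 0
  q = mkℚᵘ (+ n) 0
  eq : + (m ℕ.* n) ℤ.* + 1 ≡ (+ m ℤ.* + n) ℤ.* + 1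
  eq = cong (ℤ._* + 1) (ℤP.pos-* m n)

ℕ→ℚ-suc : ∀ n → ℕ→ℚ (suc n) ≡ 1ℚ + ℕ→ℚ n
ℕ→ℚ-suc = ℕ→ℚ-homo-+ 1

ℕ→ℚ-homo-∸ : ∀ {m n} → n ≤ m → ℕ→ℚ (m ℕ.∸ n) ≡ ℕ→ℚ m - ℕ→ℚ n
ℕ→ℚ-homo-∸ {m} {n} n≤m = begin
  ℕ→ℚ (m ℕ.∸ n)                   ≡⟨ solve 2 (λ a b → a := (a :+ b) :- b) refl (ℕ→ℚ (m ℕ.∸ n)) (ℕ→ℚ n) ⟩
  (ℕ→ℚ (m ℕ.∸ n) + ℕ→ℚ n) - ℕ→ℚ n ≡⟨ cong (_- ℕ→ℚ n) (ℕ→ℚ-homo-+ (m ℕ.∸ n) n) ⟨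
  ℕ→ℚ (m ℕ.∸ n ℕ.+ n) - ℕ→ℚ n     ≡⟨ cong (λ t → ℕ→ℚ t - ℕ→ℚ n) (ℕP.m∸n+n≡m n≤m) ⟩
  ℕ→ℚ m - ℕ→ℚ n                   ∎

1/[1+n]*[1+n]≡1 : ∀ n → ((+ 1) / suc n) * ℕ→ℚ (suc n) ≡ 1ℚ
1/[1+n]*[1+n]≡1 n =
  trans (sym (fromℚᵘ-homo-* p q)) (ℚP.fromℚᵘ-cong {p ℚᵘ.* q} {mkℚᵘ (+ 1) 0} (*≡* eq))
  where
  p = mkℚᵘ (+ 1) n
  q = mkℚᵘ (+ suc n) 0
  eq : (+ 1 ℤ.* + suc n) ℤ.* + 1 ≡ + 1 ℤ.* + suc (n ℕ.* 1)
  eq = trans (ℤP.*-identityʳ (+ 1 ℤ.* + suc n))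
             (cong (λ t → + 1 ℤ.* + suc t) (sym (ℕP.*-identityʳ n)))

m/[1+n]≡m*1/[1+n] : ∀ m n → (+ m) / suc n ≡ ℕ→ℚ m * ((+ 1) / suc n)
m/[1+n]≡m*1/[1+n] m n =
  trans (ℚP.fromℚᵘ-cong {mkℚᵘ (+ m) n} {p ℚᵘ.* q} (*≡* eq)) (fromℚᵘ-homo-* p q)
  where
  p = mkℚᵘ (+ m) 0
  q = mkℚᵘ (+ 1) n
  eq : + m ℤ.* + suc (n ℕ.+ 0) ≡ (+ m ℤ.* + 1) ℤ.* + suc n
  eq = cong₂ ℤ._*_ (sym (ℤP.*-identityʳ (+ m))) (cong (λ t → + suc t) (ℕP.+-identityʳ n))

p≡q⇒p-q≡0 : ∀ {p q : ℚ} → p ≡ q → p - q ≡ 0ℚ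
p≡q⇒p-q≡0 {p} refl = ℚP.+-inverseʳ p

inv-inverseʳ : ∀ q → q ≢ 0ℚ → q * inv q ≡ 1ℚ
inv-inverseʳ q q≢0 with q ℚP.≟ 0ℚ
... | yes q≡0 = ⊥-elim (q≢0 q≡0)
... | no  q≢0 = ℚP.*-inverseʳ q {{ℚ.≢-nonZero q≢0}}

Σ< : ℕ → (ℕ → ℚ) → ℚ
Σ< zero    f = 0ℚ
Σ< (suc n) f = Σ< n f + f n

Σ<-cong : ∀ n {f h : ℕ → ℚ} → (∀ k → k < n → f k ≡ h k) → Σ< n f ≡ Σ< n h
Σ<-cong zero    f≡h = refl
Σ<-cong (suc n) f≡h =
  cong₂ _+_ (Σ<-cong n (λ k k<n → f≡h k (ℕP.m<n⇒m<1+n k<n))) (f≡h n (ℕP.n<1+n n))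

Σ<-distrib-+ : ∀ n f h → Σ< n (λ k → f k + h k) ≡ Σ< n f + Σ< n h
Σ<-distrib-+ zero    f h = refl
Σ<-distrib-+ (suc n) f h = trans (cong (_+ (f n + h n)) (Σ<-distrib-+ n f h))
  (solve 4 (λ a b c d → (a :+ b) :+ (c :+ d) := (a :+ c) :+ (b :+ d))
     refl (Σ< n f) (Σ< n h) (f n) (h n))

*-distribˡ-Σ< : ∀ n c f → Σ< n (λ k → c * f k) ≡ c * Σ< n f
*-distribˡ-Σ< zero    c f = sym (ℚP.*-zeroʳ c)
*-distribˡ-Σ< (suc n) c f =
  trans (cong (_+ c * f n) (*-distribˡ-Σ< n c f)) (sym (ℚP.*-distribˡ-+ c (Σ< n f) (f n)))

Σ<-head : ∀ n f → Σ< (suc n) f ≡ f 0 + Σ< n (λ k → f (suc k))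
Σ<-head zero    f = trans (ℚP.+-identityˡ (f 0)) (sym (ℚP.+-identityʳ (f 0)))
Σ<-head (suc n) f = trans (cong (_+ f (suc n)) (Σ<-head n f)) (ℚP.+-assoc (f 0) _ _)

Σ<-vanishing-tail : ∀ {m} n f → m ≤ n → (∀ k → m ≤ k → f k ≡ 0ℚ) → Σ< n f ≡ Σ< m f
Σ<-vanishing-tail {m} n f m≤n f≡0 =
  trans (cong (λ t → Σ< t f) (sym (ℕP.m+[n∸m]≡n m≤n))) (extend (n ℕ.∸ m))
  where
  extend : ∀ d → Σ< (m ℕ.+ d) f ≡ Σ< m f
  extend zero    = cong (λ t → Σ< t f) (ℕP.+-identityʳ m)
  extend (suc d) = begin
    Σ< (m ℕ.+ suc d) f           ≡⟨ cong (λ t → Σ< t f) (ℕP.+-suc m d) ⟩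
    Σ< (m ℕ.+ d) f + f (m ℕ.+ d) ≡⟨ cong₂ _+_ (extend d) (f≡0 (m ℕ.+ d) (ℕP.m≤m+n m d)) ⟩
    Σ< m f + 0ℚ                  ≡⟨ ℚP.+-identityʳ _ ⟩
    Σ< m f                       ∎

sumTo≡Σ< : ∀ k f → sumTo k f ≡ Σ< (suc k) f
sumTo≡Σ< zero    f = sym (ℚP.+-identityˡ (f 0))
sumTo≡Σ< (suc k) f = cong (_+ f (suc k)) (sumTo≡Σ< k f)

sumFin≡Σ< : ∀ n h → sumFin n (λ c → h (toℕ c)) ≡ Σ< n h
sumFin≡Σ< zero    h = refl
sumFin≡Σ< (suc n) h =
  trans (cong (λ t → h 0 + t) (sumFin≡Σ< n (λ k → h (suc k)))) (sym (Σ<-head n h))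

telescope : ∀ (α β P : ℕ → ℚ) m → α 0 ≡ 0ℚ → (∀ c → suc c ≤ m → α (suc c) + β c ≡ 0ℚ) →
            Σ< m (λ c → α c * P c + β c * P (suc c)) + α m * P m ≡ 0ℚ
telescope α β P zero    α0≡0 αβ≡0 =
  trans (ℚP.+-identityˡ _) (trans (cong (_* P 0) α0≡0) (ℚP.*-zeroˡ (P 0)))
telescope α β P (suc m) α0≡0 αβ≡0 = begin
  (S + (α m * P m + β m * P (suc m))) + α (suc m) * P (suc m)
    ≡⟨ solve 6 (λ S a b c p q → (S :+ (a :* p :+ b :* q)) :+ c :* q := (S :+ a :* p) :+ (c :+ b) :* q)
         refl S (α m) (β m) (α (suc m)) (P m) (P (suc m)) ⟩
  (S + α m * P m) + (α (suc m) + β m) * P (suc m)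
    ≡⟨ cong₂ (λ u v → u + v * P (suc m))
         (telescope α β P m α0≡0 (λ c c<m → αβ≡0 c (ℕP.m≤n⇒m≤1+n c<m))) (αβ≡0 m ℕP.≤-refl) ⟩
  0ℚ + 0ℚ * P (suc m)
    ≡⟨ solve 1 (λ p → con 0ℚ :+ con 0ℚ :* p := con 0ℚ) refl (P (suc m)) ⟩
  0ℚ ∎
  where S = Σ< m (λ c → α c * P c + β c * P (suc c))

addNext : (ℕ → ℚ) → ℕ → ℚ
addNext v k = v k + v (suc k)

addPrev : (ℕ → ℚ) → ℕ → ℚ
addPrev u zero    = u 0
addPrev u (suc k) = u k + u (suc k)

summation-by-parts : ∀ M u v → u M ≡ 0ℚ →
  Σ< (suc M) (λ k → addPrev u k * v k) ≡ Σ< (suc M) (λ k → u k * addNext v k)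
summation-by-parts M u v uM≡0 = begin
  S                      ≡⟨ solve 2 (λ S p → S := S :+ con 0ℚ :* p) refl S (v (suc M)) ⟩
  S + 0ℚ * v (suc M)     ≡⟨ cong (λ t → S + t * v (suc M)) uM≡0 ⟨
  S + u M * v (suc M)    ≡⟨ with-boundary M ⟩
  Σ< (suc M) (λ k → u k * addNext v k) ∎
  where
  S = Σ< (suc M) (λ k → addPrev u k * v k)

  with-boundary : ∀ m → Σ< (suc m) (λ k → addPrev u k * v k) + u m * v (suc m)
                      ≡ Σ< (suc m) (λ k → u k * addNext v k)
  with-boundary zero = solve 3 (λ a b c → (con 0ℚ :+ a :* b) :+ a :* c := con 0ℚ :+ a :* (b :+ c))
    refl (u 0) (v 0) (v 1)
  with-boundary (suc m) = begin
    (Σm + (u m + u (suc m)) * v (suc m)) + u (suc m) * v (suc (suc m))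
      ≡⟨ solve 5 (λ S a b p q → (S :+ (b :+ a) :* p) :+ a :* q := (S :+ b :* p) :+ a :* (p :+ q))
           refl Σm (u (suc m)) (u m) (v (suc m)) (v (suc (suc m))) ⟩
    (Σm + u m * v (suc m)) + u (suc m) * addNext v (suc m)
      ≡⟨ cong (_+ u (suc m) * addNext v (suc m)) (with-boundary m) ⟩
    Σ< (suc m) (λ k → u k * addNext v k) + u (suc m) * addNext v (suc m) ∎
    where Σm = Σ< (suc m) (λ k → addPrev u k * v k)

[1+k]*[1+n]C[1+k]≡[1+n]*nCk : ∀ n k → suc k ℕ.* (suc n C suc k) ≡ suc n ℕ.* (n C k)
[1+k]*[1+n]C[1+k]≡[1+n]*nCk zero    zero    = refl
[1+k]*[1+n]C[1+k]≡[1+n]*nCk zero    (suc k) = ℕP.*-zeroʳ (suc (suc k))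
[1+k]*[1+n]C[1+k]≡[1+n]*nCk (suc n) zero    =
  trans (ℕP.*-identityˡ _) (trans (nC1≡n (suc (suc n))) (sym (ℕP.*-identityʳ (suc (suc n)))))
[1+k]*[1+n]C[1+k]≡[1+n]*nCk (suc n) (suc k) = begin
  suc (suc k) ℕ.* (suc (suc n) C suc (suc k))
    ≡⟨ cong (suc (suc k) ℕ.*_) (nCk+nC[k+1]≡[n+1]C[k+1] (suc n) (suc k)) ⟨
  suc (suc k) ℕ.* (A ℕ.+ B)
    ≡⟨ rearrange k A B ⟩
  A ℕ.+ (suc k ℕ.* A ℕ.+ suc (suc k) ℕ.* B)
    ≡⟨ cong₂ (λ u v → A ℕ.+ (u ℕ.+ v))
         ([1+k]*[1+n]C[1+k]≡[1+n]*nCk n k) ([1+k]*[1+n]C[1+k]≡[1+n]*nCk n (suc k)) ⟩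
  A ℕ.+ (suc n ℕ.* (n C k) ℕ.+ suc n ℕ.* (n C suc k))
    ≡⟨ cong (A ℕ.+_) (ℕP.*-distribˡ-+ (suc n) (n C k) (n C suc k)) ⟨
  A ℕ.+ suc n ℕ.* (n C k ℕ.+ n C suc k)
    ≡⟨ cong (λ t → A ℕ.+ suc n ℕ.* t) (nCk+nC[k+1]≡[n+1]C[k+1] n k) ⟩
  suc (suc n) ℕ.* A ∎
  where
  A = suc n C suc k
  B = suc n C suc (suc k)
  rearrange : ∀ k a b → suc (suc k) ℕ.* (a ℕ.+ b) ≡ a ℕ.+ (suc k ℕ.* a ℕ.+ suc (suc k) ℕ.* b)
  rearrange = solve-∀

n*nCk≡k*nCk+[1+k]*nC[1+k] : ∀ n k → n ℕ.* (n C k) ≡ k ℕ.* (n C k) ℕ.+ suc k ℕ.* (n C suc k)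
n*nCk≡k*nCk+[1+k]*nC[1+k] n k = ℕP.+-cancelˡ-≡ (n C k) _ _ (begin
  suc n ℕ.* (n C k)                       ≡⟨ [1+k]*[1+n]C[1+k]≡[1+n]*nCk n k ⟨
  suc k ℕ.* (suc n C suc k)               ≡⟨ cong (suc k ℕ.*_) (nCk+nC[k+1]≡[n+1]C[k+1] n k) ⟨
  suc k ℕ.* (n C k ℕ.+ n C suc k)         ≡⟨ rearrange k (n C k) (n C suc k) ⟩
  n C k ℕ.+ (k ℕ.* (n C k) ℕ.+ suc k ℕ.* (n C suc k)) ∎)
  where
  rearrange : ∀ k a b → suc k ℕ.* (a ℕ.+ b) ≡ a ℕ.+ (k ℕ.* a ℕ.+ suc k ℕ.* b)
  rearrange = solve-∀

binom : ℕ → ℕ → ℚ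
binom n k = ℕ→ℚ (n C k)

binom-pascal : ∀ n k → binom (suc n) (suc k) ≡ binom n k + binom n (suc k)
binom-pascal n k =
  trans (cong ℕ→ℚ (sym (nCk+nC[k+1]≡[n+1]C[k+1] n k))) (ℕ→ℚ-homo-+ (n C k) (n C suc k))

binom-vanish : ∀ {n k} → n < k → binom n k ≡ 0ℚ
binom-vanish n<k = cong ℕ→ℚ (k>n⇒nCk≡0 n<k)

binom-absorption : ∀ n k → ℕ→ℚ (suc k) * binom (suc n) (suc k) ≡ ℕ→ℚ (suc n) * binom n k
binom-absorption n k = trans (sym (ℕ→ℚ-homo-* (suc k) (suc n C suc k)))
  (trans (cong ℕ→ℚ ([1+k]*[1+n]C[1+k]≡[1+n]*nCk n k)) (ℕ→ℚ-homo-* (suc n) (n C k)))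

binom-ratio : ∀ n k → ℕ→ℚ n * binom n k ≡ ℕ→ℚ k * binom n k + ℕ→ℚ (suc k) * binom n (suc k)
binom-ratio n k = trans (sym (ℕ→ℚ-homo-* n (n C k)))
  (trans (cong ℕ→ℚ (n*nCk≡k*nCk+[1+k]*nC[1+k] n k))
  (trans (ℕ→ℚ-homo-+ (k ℕ.* (n C k)) (suc k ℕ.* (n C suc k)))
         (cong₂ _+_ (ℕ→ℚ-homo-* k (n C k)) (ℕ→ℚ-homo-* (suc k) (n C suc k)))))

binom-central-sym : ∀ i → binom (suc (2 ℕ.* i)) i ≡ binom (suc (2 ℕ.* i)) (suc i)
binom-central-sym i = cong ℕ→ℚ (trans (nCk≡nC[n∸k] i≤n) (cong (suc (2 ℕ.* i) C_) n∸i≡1+i))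
  where
  i≤n : i ≤ suc (2 ℕ.* i)
  i≤n = ℕP.m≤n⇒m≤1+n (ℕP.m≤m+n i (i ℕ.+ 0))
  1+2i≡1+i+i : ∀ i → suc (2 ℕ.* i) ≡ suc i ℕ.+ i
  1+2i≡1+i+i = solve-∀
  n∸i≡1+i : suc (2 ℕ.* i) ℕ.∸ i ≡ suc i
  n∸i≡1+i = trans (cong (ℕ._∸ i) (1+2i≡1+i+i i)) (ℕP.m+n∸n≡m (suc i) i)

two : ℚ
two = ℕ→ℚ 2

ℕ→ℚ-double : ∀ m → ℕ→ℚ (2 ℕ.* m) ≡ two * ℕ→ℚ m
ℕ→ℚ-double = ℕ→ℚ-homo-* 2

-- Ballot numbers

Δbinom : ℕ → ℕ → ℚ
Δbinom n j = binom n j - binom n (suc j)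

Δbinom-pascal : ∀ n j → Δbinom (suc n) (suc j) ≡ Δbinom n j + Δbinom n (suc j)
Δbinom-pascal n j = trans (cong₂ _-_ (binom-pascal n j) (binom-pascal n (suc j)))
  (solve 3 (λ b₀ b₁ b₂ → (b₀ :+ b₁) :- (b₁ :+ b₂) := (b₀ :- b₁) :+ (b₁ :- b₂))
     refl (binom n j) (binom n (suc j)) (binom n (suc (suc j))))

Δbinom-vanish : ∀ {n j} → n < j → Δbinom n j ≡ 0ℚ
Δbinom-vanish n<j = cong₂ _-_ (binom-vanish n<j) (binom-vanish (ℕP.m<n⇒m<1+n n<j))

-- ballot i k is the paper's binom(2i, i-k) - binom(2i, i-k-1), reflected by
-- the symmetry of binomial coefficients so that no index can go negative.
ballot : ℕ → ℕ → ℚ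
ballot i k = Δbinom (2 ℕ.* i) (i ℕ.+ k)

ballot′ : ℕ → ℕ → ℚ
ballot′ i k = Δbinom (suc (2 ℕ.* i)) (suc (i ℕ.+ k))

2i<i+k : ∀ {i k} → i < k → 2 ℕ.* i < i ℕ.+ k
2i<i+k {i} {k} i<k = ℕP.+-monoʳ-< i (subst (_< k) (sym (ℕP.+-identityʳ i)) i<k)

ballot-vanish : ∀ {i k} → i < k → ballot i k ≡ 0ℚ
ballot-vanish i<k = Δbinom-vanish (2i<i+k i<k)

ballot′-vanish : ∀ {i k} → i < k → ballot′ i k ≡ 0ℚ
ballot′-vanish i<k = Δbinom-vanish (s≤s (2i<i+k i<k))

ballot-diag : ∀ i → ballot i i ≡ 1ℚ
ballot-diag i = subst (λ n → Δbinom n (i ℕ.+ i) ≡ 1ℚ) (cong (i ℕ.+_) (sym (ℕP.+-identityʳ i)))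
  (cong₂ _-_ (cong ℕ→ℚ (nCn≡1 (i ℕ.+ i))) (binom-vanish (ℕP.n<1+n (i ℕ.+ i))))

ballot′≡addNext-ballot : ∀ i k → ballot′ i k ≡ addNext (ballot i) k
ballot′≡addNext-ballot i k = trans (Δbinom-pascal (2 ℕ.* i) (i ℕ.+ k))
  (cong (λ j → ballot i k + Δbinom (2 ℕ.* i) j) (sym (ℕP.+-suc i k)))

ballot-suc≡addPrev-ballot′ : ∀ i k → ballot (suc i) k ≡ addPrev (ballot′ i) k
ballot-suc≡addPrev-ballot′ i zero = begin
  ballot (suc i) 0                 ≡⟨ pascal ⟩
  Δbinom N (i ℕ.+ 0) + ballot′ i 0 ≡⟨ cong (λ j → Δbinom N j + ballot′ i 0) (ℕP.+-identityʳ i) ⟩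
  Δbinom N i + ballot′ i 0         ≡⟨ cong (_+ ballot′ i 0) (p≡q⇒p-q≡0 (binom-central-sym i)) ⟩
  0ℚ + ballot′ i 0                 ≡⟨ ℚP.+-identityˡ _ ⟩
  ballot′ i 0                      ∎
  where
  N = suc (2 ℕ.* i)
  pascal : ballot (suc i) 0 ≡ Δbinom N (i ℕ.+ 0) + ballot′ i 0
  pascal = trans (cong (λ n → Δbinom n (suc (i ℕ.+ 0))) (ℕP.*-suc 2 i)) (Δbinom-pascal N (i ℕ.+ 0))
ballot-suc≡addPrev-ballot′ i (suc k) =
  trans (cong (λ n → Δbinom n (suc (i ℕ.+ suc k))) (ℕP.*-suc 2 i))
  (trans (Δbinom-pascal (suc (2 ℕ.* i)) (i ℕ.+ suc k))
         (cong (λ j → Δbinom (suc (2 ℕ.* i)) j + ballot′ i (suc k)) (ℕP.+-suc i k)))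

catalan≡ballot : ∀ m → catalan m ≡ ballot m 0
catalan≡ballot m = begin
  catalan m                         ≡⟨ m/[1+n]≡m*1/[1+n] ((2 ℕ.* m) C m) m ⟩
  c₀ * ρ
    ≡⟨ solve 3 (λ c₀ ρ m → c₀ :* ρ := ρ :* ((con 1ℚ :+ m) :* c₀ :- m :* c₀)) refl c₀ ρ mq ⟩
  ρ * ((1ℚ + mq) * c₀ - mq * c₀)    ≡⟨ cong (λ t → ρ * (t * c₀ - mq * c₀)) (ℕ→ℚ-suc m) ⟨
  ρ * (m₁ * c₀ - mq * c₀)           ≡⟨ cong (λ t → ρ * (m₁ * c₀ - t)) ratio ⟩
  ρ * (m₁ * c₀ - m₁ * c₁)
    ≡⟨ solve 4 (λ ρ m₁ c₀ c₁ → ρ :* (m₁ :* c₀ :- m₁ :* c₁) := ρ :* m₁ :* (c₀ :- c₁)) refl ρ m₁ c₀ c₁ ⟩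
  ρ * m₁ * (c₀ - c₁)                ≡⟨ cong (_* (c₀ - c₁)) (1/[1+n]*[1+n]≡1 m) ⟩
  1ℚ * (c₀ - c₁)                    ≡⟨ ℚP.*-identityˡ _ ⟩
  c₀ - c₁                           ≡⟨ cong (Δbinom (2 ℕ.* m)) (ℕP.+-identityʳ m) ⟨
  ballot m 0                        ∎
  where
  c₀ = binom (2 ℕ.* m) m
  c₁ = binom (2 ℕ.* m) (suc m)
  ρ = (+ 1) / suc m
  mq = ℕ→ℚ m
  m₁ = ℕ→ℚ (suc m)
  ratio : mq * c₀ ≡ m₁ * c₁
  ratio = begin
    mq * c₀
      ≡⟨ solve 2 (λ m c₀ → m :* c₀ := (con two :* m) :* c₀ :- m :* c₀) refl mq c₀ ⟩
    two * mq * c₀ - mq * c₀               ≡⟨ cong (λ t → t * c₀ - mq * c₀) (ℕ→ℚ-double m) ⟨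
    ℕ→ℚ (2 ℕ.* m) * c₀ - mq * c₀          ≡⟨ cong (_- mq * c₀) (binom-ratio (2 ℕ.* m) m) ⟩
    (mq * c₀ + m₁ * c₁) - mq * c₀
      ≡⟨ solve 2 (λ a b → (a :+ b) :- a := b) refl (mq * c₀) (m₁ * c₁) ⟩
    m₁ * c₁                               ∎

Σ<-ballot-suc : ∀ M i j → i < M →
  Σ< (suc M) (λ k → ballot (suc i) k * ballot j k) ≡ Σ< (suc M) (λ k → ballot′ i k * ballot′ j k)
Σ<-ballot-suc M i j i<M = begin
  Σ< (suc M) (λ k → ballot (suc i) k * ballot j k)
    ≡⟨ Σ<-cong (suc M) (λ k _ → cong (_* ballot j k) (ballot-suc≡addPrev-ballot′ i k)) ⟩
  Σ< (suc M) (λ k → addPrev (ballot′ i) k * ballot j k)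
    ≡⟨ summation-by-parts M (ballot′ i) (ballot j) (ballot′-vanish i<M) ⟩
  Σ< (suc M) (λ k → ballot′ i k * addNext (ballot j) k)
    ≡⟨ Σ<-cong (suc M) (λ k _ → cong (ballot′ i k *_) (ballot′≡addNext-ballot j k)) ⟨
  Σ< (suc M) (λ k → ballot′ i k * ballot′ j k) ∎

Σ<-ballot′ : ∀ M i j → j < M →
  Σ< (suc M) (λ k → ballot′ i k * ballot′ j k) ≡ Σ< (suc M) (λ k → ballot i k * ballot (suc j) k)
Σ<-ballot′ M i j j<M = begin
  Σ< (suc M) (λ k → ballot′ i k * ballot′ j k)
    ≡⟨ Σ<-cong (suc M) (λ k _ → ℚP.*-comm (ballot′ i k) (ballot′ j k)) ⟩
  Σ< (suc M) (λ k → ballot′ j k * ballot′ i k)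
    ≡⟨ Σ<-ballot-suc M j i j<M ⟨
  Σ< (suc M) (λ k → ballot (suc j) k * ballot i k)
    ≡⟨ Σ<-cong (suc M) (λ k _ → ℚP.*-comm (ballot (suc j) k) (ballot i k)) ⟩
  Σ< (suc M) (λ k → ballot i k * ballot (suc j) k) ∎

hankel-identity : ∀ M i j → i ℕ.+ j < M →
  Σ< (suc M) (λ k → ballot i k * ballot j k) ≡ ballot (i ℕ.+ j) 0
hankel-identity M zero j _ = begin
  Σ< (suc M) (λ k → ballot 0 k * ballot j k)
    ≡⟨ Σ<-vanishing-tail (suc M) _ (s≤s z≤n)
         (λ k 0<k → trans (cong (_* ballot j k) (ballot-vanish 0<k)) (ℚP.*-zeroˡ (ballot j k))) ⟩
  0ℚ + 1ℚ * ballot j 0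
    ≡⟨ solve 1 (λ b → con 0ℚ :+ con 1ℚ :* b := b) refl (ballot j 0) ⟩
  ballot j 0 ∎
hankel-identity M (suc i) j i+j<M = begin
  Σ< (suc M) (λ k → ballot (suc i) k * ballot j k)
    ≡⟨ Σ<-ballot-suc M i j (ℕP.≤-<-trans (ℕP.m≤n⇒m≤1+n (ℕP.m≤m+n i j)) i+j<M) ⟩
  Σ< (suc M) (λ k → ballot′ i k * ballot′ j k)
    ≡⟨ Σ<-ballot′ M i j (ℕP.≤-<-trans (ℕP.m≤n+m j (suc i)) i+j<M) ⟩
  Σ< (suc M) (λ k → ballot i k * ballot (suc j) k)
    ≡⟨ hankel-identity M i (suc j) (subst (_< M) (sym (ℕP.+-suc i j)) i+j<M) ⟩
  ballot (i ℕ.+ suc j) 0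
    ≡⟨ cong (λ t → ballot t 0) (ℕP.+-suc i j) ⟩
  ballot (suc i ℕ.+ j) 0 ∎

Σ<-ballot*ballot : ∀ n a b → a < n → Σ< n (λ k → ballot a k * ballot b k) ≡ catalan (a ℕ.+ b)
Σ<-ballot*ballot n a b a<n = begin
  Σ< n f                 ≡⟨ Σ<-vanishing-tail n f a<n f-vanish ⟩
  Σ< (suc a) f           ≡⟨ Σ<-vanishing-tail (suc M) f (s≤s (ℕP.m≤n⇒m≤1+n (ℕP.m≤m+n a b))) f-vanish ⟨
  Σ< (suc M) f           ≡⟨ hankel-identity M a b (ℕP.n<1+n (a ℕ.+ b)) ⟩
  ballot (a ℕ.+ b) 0     ≡⟨ catalan≡ballot (a ℕ.+ b) ⟨
  catalan (a ℕ.+ b)      ∎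
  where
  M = suc (a ℕ.+ b)
  f = λ k → ballot a k * ballot b k
  f-vanish : ∀ k → suc a ≤ k → f k ≡ 0ℚ
  f-vanish k a<k = trans (cong (_* ballot b k) (ballot-vanish a<k)) (ℚP.*-zeroˡ (ballot b k))

Σ<-ballot′*ballot′ : ∀ n a b → a < n → Σ< n (λ k → ballot′ a k * ballot′ b k) ≡ catalan (suc (a ℕ.+ b))
Σ<-ballot′*ballot′ n a b a<n = begin
  Σ< n f                                    ≡⟨ Σ<-vanishing-tail n f a<n f-vanish ⟩
  Σ< (suc a) f                              ≡⟨ Σ<-vanishing-tail (suc M) f a<M f-vanish ⟨
  Σ< (suc M) f                              ≡⟨ Σ<-ballot′ M a b (s≤s (ℕP.m≤n⇒m≤1+n (ℕP.m≤n+m b a))) ⟩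
  Σ< (suc M) (λ k → ballot a k * ballot (suc b) k)
    ≡⟨ hankel-identity M a (suc b) (subst (_< M) (sym (ℕP.+-suc a b)) (ℕP.n<1+n _)) ⟩
  ballot (a ℕ.+ suc b) 0                    ≡⟨ cong (λ t → ballot t 0) (ℕP.+-suc a b) ⟩
  ballot (suc (a ℕ.+ b)) 0                  ≡⟨ catalan≡ballot (suc (a ℕ.+ b)) ⟨
  catalan (suc (a ℕ.+ b))                   ∎
  where
  M = suc (suc (a ℕ.+ b))
  f = λ k → ballot′ a k * ballot′ b k
  a<M : suc a ≤ suc M
  a<M = s≤s (ℕP.m≤n⇒m≤1+n (ℕP.m≤n⇒m≤1+n (ℕP.m≤m+n a b)))
  f-vanish : ∀ k → suc a ≤ k → f k ≡ 0ℚ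
  f-vanish k a<k = trans (cong (_* ballot′ b k) (ballot′-vanish a<k)) (ℚP.*-zeroˡ (ballot′ b k))

-- The polynomials g

2k∸r<r : ∀ {k r} → k < r → 2 ℕ.* k ℕ.∸ r < r
2k∸r<r {k} {suc r} k<r = ℕP.m<n+o⇒m∸n<o (2 ℕ.* k) (suc r)
  (ℕP.+-mono-< k<r (subst (_< suc r) (sym (ℕP.+-identityʳ k)) k<r))

module _ (x : ℚ) where

  fibonacci : ℕ → ℚ
  fibonacci n = Σ< (suc n) (λ r → binom (n ℕ.∸ r) r * x ^ r)

  g≡fibonacci : ∀ k → g k x ≡ fibonacci (2 ℕ.* k)
  g≡fibonacci k = trans (sumTo≡Σ< k φ)
    (sym (Σ<-vanishing-tail (suc (2 ℕ.* k)) φ (s≤s (ℕP.m≤m+n k (k ℕ.+ 0))) φ-vanish))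
    where
    φ = λ r → binom (2 ℕ.* k ℕ.∸ r) r * x ^ r
    φ-vanish : ∀ r → suc k ≤ r → φ r ≡ 0ℚ
    φ-vanish r k<r = trans (cong (_* x ^ r) (binom-vanish (2k∸r<r k<r))) (ℚP.*-zeroˡ (x ^ r))

  fibonacci-rec : ∀ n → fibonacci (suc (suc n)) ≡ fibonacci (suc n) + x * fibonacci n
  fibonacci-rec n = begin
    Σ< (suc (suc (suc n))) h₂
      ≡⟨ Σ<-head (suc (suc n)) h₂ ⟩
    h₂ 0 + (Σ< (suc n) (λ s → h₂ (suc s)) + h₂ (suc (suc n)))
      ≡⟨ cong₂ (λ u v → h₂ 0 + (u + v)) (Σ<-cong (suc n) pascal) last-vanishes ⟩
    h₁ 0 + (Σ< (suc n) (λ s → h₁ (suc s) + x * h₀ s) + 0ℚ)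
      ≡⟨ cong (λ u → h₁ 0 + (u + 0ℚ)) split ⟩
    h₁ 0 + ((Σ< (suc n) (λ s → h₁ (suc s)) + x * Σ< (suc n) h₀) + 0ℚ)
      ≡⟨ solve 4 (λ a b c d → a :+ ((b :+ c :* d) :+ con 0ℚ) := (a :+ b) :+ c :* d)
           refl (h₁ 0) (Σ< (suc n) (λ s → h₁ (suc s))) x (Σ< (suc n) h₀) ⟩
    (h₁ 0 + Σ< (suc n) (λ s → h₁ (suc s))) + x * Σ< (suc n) h₀
      ≡⟨ cong (_+ x * Σ< (suc n) h₀) (Σ<-head (suc n) h₁) ⟨
    Σ< (suc (suc n)) h₁ + x * Σ< (suc n) h₀ ∎
    where
    h₂ h₁ h₀ : ℕ → ℚ
    h₂ r = binom (suc (suc n) ℕ.∸ r) r * x ^ r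
    h₁ r = binom (suc n ℕ.∸ r) r * x ^ r
    h₀ r = binom (n ℕ.∸ r) r * x ^ r
    pascal : ∀ s → s < suc n → h₂ (suc s) ≡ h₁ (suc s) + x * h₀ s
    pascal s s<1+n = begin
      binom (suc n ℕ.∸ s) (suc s) * (x * x ^ s)
        ≡⟨ cong (λ t → binom t (suc s) * (x * x ^ s)) (ℕP.+-∸-assoc 1 (ℕP.≤-pred s<1+n)) ⟩
      binom (suc (n ℕ.∸ s)) (suc s) * (x * x ^ s)
        ≡⟨ cong (_* (x * x ^ s)) (binom-pascal (n ℕ.∸ s) s) ⟩
      (binom (n ℕ.∸ s) s + binom (n ℕ.∸ s) (suc s)) * (x * x ^ s)
        ≡⟨ solve 4 (λ a b x p → (a :+ b) :* (x :* p) := b :* (x :* p) :+ x :* (a :* p))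
             refl (binom (n ℕ.∸ s) s) (binom (n ℕ.∸ s) (suc s)) x (x ^ s) ⟩
      binom (n ℕ.∸ s) (suc s) * (x * x ^ s) + x * (binom (n ℕ.∸ s) s * x ^ s) ∎
    last-vanishes : h₂ (suc (suc n)) ≡ 0ℚ
    last-vanishes = trans (cong (_* x ^ suc (suc n))
        (binom-vanish (s≤s (ℕP.m≤n⇒m≤1+n (ℕP.m∸n≤m n n)))))
      (ℚP.*-zeroˡ (x ^ suc (suc n)))
    split : Σ< (suc n) (λ s → h₁ (suc s) + x * h₀ s)
          ≡ Σ< (suc n) (λ s → h₁ (suc s)) + x * Σ< (suc n) h₀
    split = trans (Σ<-distrib-+ (suc n) (λ s → h₁ (suc s)) (λ s → x * h₀ s))
                  (cong (λ t → Σ< (suc n) (λ s → h₁ (suc s)) + t) (*-distribˡ-Σ< (suc n) x h₀))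

  g-rec : ∀ c → g (suc (suc c)) x + x * x * g c x ≡ (1ℚ + (x + x)) * g (suc c) x
  g-rec c = begin
    g (suc (suc c)) x + x * x * g c x
      ≡⟨ cong₂ (λ u v → u + x * x * v) (g≡fibonacci (suc (suc c))) (g≡fibonacci c) ⟩
    fibonacci (2 ℕ.* suc (suc c)) + x * x * fibonacci m
      ≡⟨ cong (λ t → fibonacci t + x * x * fibonacci m) (2*[2+c]≡4+2c c) ⟩
    fibonacci (suc (suc (suc (suc m)))) + x * x * fibonacci m
      ≡⟨ cong (_+ x * x * fibonacci m) (trans (fibonacci-rec (suc (suc m)))
           (cong₂ (λ u v → u + x * v) (fibonacci-rec (suc m)) (fibonacci-rec m))) ⟩
    ((fibonacci (suc (suc m)) + x * f₁) + x * (f₁ + x * f₀)) + x * x * f₀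
      ≡⟨ cong (λ u → ((u + x * f₁) + x * (f₁ + x * f₀)) + x * x * f₀) (fibonacci-rec m) ⟩
    (((f₁ + x * f₀) + x * f₁) + x * (f₁ + x * f₀)) + x * x * f₀
      ≡⟨ solve 3 (λ x a b → (((b :+ x :* a) :+ x :* b) :+ x :* (b :+ x :* a)) :+ x :* x :* a
                          := (con 1ℚ :+ (x :+ x)) :* (b :+ x :* a)) refl x f₀ f₁ ⟩
    (1ℚ + (x + x)) * (f₁ + x * f₀)
      ≡⟨ cong ((1ℚ + (x + x)) *_) (fibonacci-rec m) ⟨
    (1ℚ + (x + x)) * fibonacci (suc (suc m))
      ≡⟨ cong (λ t → (1ℚ + (x + x)) * fibonacci t) (ℕP.*-suc 2 c) ⟨
    (1ℚ + (x + x)) * fibonacci (2 ℕ.* suc c)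
      ≡⟨ cong ((1ℚ + (x + x)) *_) (g≡fibonacci (suc c)) ⟨
    (1ℚ + (x + x)) * g (suc c) x ∎
    where
    m = 2 ℕ.* c
    f₀ = fibonacci m
    f₁ = fibonacci (suc m)
    2*[2+c]≡4+2c : ∀ c → 2 ℕ.* suc (suc c) ≡ suc (suc (suc (suc (2 ℕ.* c))))
    2*[2+c]≡4+2c = solve-∀

  -- g 1 x unfolds to 1 * 1 + 1 * (x * 1).
  g-one : g 1 x ≡ 1ℚ + x
  g-one = solve 1 (λ x → con 1ℚ :* con 1ℚ :+ con 1ℚ :* (x :* con 1ℚ) := con 1ℚ :+ x) refl x

-- The closed form of F

half : ℚ
half = (+ 1) / 2

-- With B_j = C(2i, i+k+j), T = C(2i+2, i+k+2) and D = 2I(2I-1) (I = i+1), these are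
-- the identities T c₁ = D b(i,k) and T c₂ = D b(i,k+1) behind the closed form of F.
-- Each is a linear combination of the two ratio identities between the B_j; the
-- multipliers handed to certificate are the coefficients of that combination.
module _ (i k B₀ B₁ B₂ : ℚ)
  (ratio₀ : two * i * B₀ ≡ (i + k) * B₀ + (1ℚ + (i + k)) * B₁)
  (ratio₁ : two * i * B₁ ≡ (1ℚ + (i + k)) * B₁ + (1ℚ + (1ℚ + (i + k))) * B₂) where

  private
    T D r₀ r₁ : ℚ
    T = (B₀ + B₁) + (B₁ + B₂)
    D = two * ((1ℚ + i) * (1ℚ + two * i))
    r₀ = two * i * B₀ - ((i + k) * B₀ + (1ℚ + (i + k)) * B₁)
    r₁ = two * i * B₁ - ((1ℚ + (i + k)) * B₁ + (1ℚ + (1ℚ + (i + k))) * B₂)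

    certificate : ∀ (X a b : ℚ) → X + a * r₀ + b * r₁ ≡ X
    certificate X a b = begin
      X + a * r₀ + b * r₁
        ≡⟨ cong₂ (λ u v → X + a * u + b * v) (p≡q⇒p-q≡0 ratio₀) (p≡q⇒p-q≡0 ratio₁) ⟩
      X + a * 0ℚ + b * 0ℚ
        ≡⟨ solve 3 (λ X a b → X :+ a :* con 0ℚ :+ b :* con 0ℚ := X) refl X a b ⟩
      X ∎

  ballot-coefficient₀ : T * ((two * (1ℚ + k) - 1ℚ) * ((1ℚ + i) + (1ℚ + k))) ≡ D * (B₀ - B₁)
  ballot-coefficient₀ = trans
    (solve 5 (λ i k b₀ b₁ b₂ →
       ((b₀ :+ b₁) :+ (b₁ :+ b₂)) :* ((c2 :* (c1 :+ k) :- c1) :* ((c1 :+ i) :+ (c1 :+ k)))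
       := c2 :* ((c1 :+ i) :* (c1 :+ c2 :* i)) :* (b₀ :- b₁)
          :+ (:- (c2 :* k :+ con (ℕ→ℚ 4) :* i :+ con (ℕ→ℚ 5)))
             :* (c2 :* i :* b₀ :- ((i :+ k) :* b₀ :+ (c1 :+ (i :+ k)) :* b₁))
          :+ (:- (c2 :* k :+ c1))
             :* (c2 :* i :* b₁ :- ((c1 :+ (i :+ k)) :* b₁ :+ (c1 :+ (c1 :+ (i :+ k))) :* b₂)))
       refl i k B₀ B₁ B₂)
    (certificate (D * (B₀ - B₁)) (- (two * k + ℕ→ℚ 4 * i + ℕ→ℚ 5)) (- (two * k + 1ℚ)))
    where c1 = con 1ℚ; c2 = con two

  ballot-coefficient₁ : T * ((two * (1ℚ + k) + 1ℚ) * ((1ℚ + i) - (1ℚ + k))) ≡ D * (B₁ - B₂)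
  ballot-coefficient₁ = trans
    (solve 5 (λ i k b₀ b₁ b₂ →
       ((b₀ :+ b₁) :+ (b₁ :+ b₂)) :* ((c2 :* (c1 :+ k) :+ c1) :* ((c1 :+ i) :- (c1 :+ k)))
       := c2 :* ((c1 :+ i) :* (c1 :+ c2 :* i)) :* (b₁ :- b₂)
          :+ (c2 :* k :+ con (ℕ→ℚ 3))
             :* (c2 :* i :* b₀ :- ((i :+ k) :* b₀ :+ (c1 :+ (i :+ k)) :* b₁))
          :+ (c2 :* k :- con (ℕ→ℚ 4) :* i :- c1)
             :* (c2 :* i :* b₁ :- ((c1 :+ (i :+ k)) :* b₁ :+ (c1 :+ (c1 :+ (i :+ k))) :* b₂)))
       refl i k B₀ B₁ B₂)
    (certificate (D * (B₁ - B₂)) (two * k + ℕ→ℚ 3) (two * k - ℕ→ℚ 4 * i - 1ℚ))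
    where c1 = con 1ℚ; c2 = con two

binomℤ-⊖ : ∀ n k → binomℤ (2 ℕ.* n) (n ℤ.⊖ k) ≡ (2 ℕ.* n) C (n ℕ.+ k)
binomℤ-⊖ n k with k ≤? n
... | yes k≤n = begin
  binomℤ (2 ℕ.* n) (n ℤ.⊖ k)
    ≡⟨ cong (binomℤ (2 ℕ.* n)) (ℤP.⊖-≥ k≤n) ⟩
  (2 ℕ.* n) C d
    ≡⟨ nCk≡nC[n∸k] (ℕP.≤-trans (ℕP.m∸n≤m n k) (ℕP.m≤m+n n (n ℕ.+ 0))) ⟩
  (2 ℕ.* n) C (2 ℕ.* n ℕ.∸ d)
    ≡⟨ cong ((2 ℕ.* n) C_) (subst (λ m → 2 ℕ.* m ℕ.∸ d ≡ m ℕ.+ k) d+k≡n (reflect d k)) ⟩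
  (2 ℕ.* n) C (n ℕ.+ k) ∎
  where
  d = n ℕ.∸ k
  d+k≡n : d ℕ.+ k ≡ n
  d+k≡n = ℕP.m∸n+n≡m k≤n
  2[d+k]≡d+[d+k+k] : ∀ d k → 2 ℕ.* (d ℕ.+ k) ≡ d ℕ.+ (d ℕ.+ k ℕ.+ k)
  2[d+k]≡d+[d+k+k] = solve-∀
  reflect : ∀ d k → 2 ℕ.* (d ℕ.+ k) ℕ.∸ d ≡ d ℕ.+ k ℕ.+ k
  reflect d k = trans (cong (ℕ._∸ d) (2[d+k]≡d+[d+k+k] d k)) (ℕP.m+n∸m≡n d (d ℕ.+ k ℕ.+ k))
... | no k≰n = begin
  binomℤ (2 ℕ.* n) (n ℤ.⊖ k)             ≡⟨ cong (binomℤ (2 ℕ.* n)) (ℤP.⊖-< n<k) ⟩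
  binomℤ (2 ℕ.* n) (ℤ.- (+ (k ℕ.∸ n)))    ≡⟨ negative-index (ℕP.m<n⇒0<n∸m n<k) ⟩
  0                                        ≡⟨ k>n⇒nCk≡0 (2i<i+k n<k) ⟨
  (2 ℕ.* n) C (n ℕ.+ k)                   ∎
  where
  n<k = ℕP.≰⇒> k≰n
  negative-index : ∀ {a m} → 0 < m → binomℤ a (ℤ.- (+ m)) ≡ 0
  negative-index {m = suc _} _ = refl


c₁ c₂ : ℕ → ℕ → ℚ
c₁ k i = (two * ℕ→ℚ (suc k) - 1ℚ) * (ℕ→ℚ (suc i) + ℕ→ℚ (suc k))
c₂ k i = (two * ℕ→ℚ (suc k) + 1ℚ) * (ℕ→ℚ (suc i) - ℕ→ℚ (suc k))

module _ (k i : ℕ) where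

  private
    N j : ℕ
    N = 2 ℕ.* i
    j = i ℕ.+ k
    iq kq B₀ B₁ B₂ : ℚ
    iq = ℕ→ℚ i
    kq = ℕ→ℚ k
    B₀ = binom N j
    B₁ = binom N (suc j)
    B₂ = binom N (suc (suc j))

    ℕ→ℚ-j : ℕ→ℚ j ≡ iq + kq
    ℕ→ℚ-j = ℕ→ℚ-homo-+ i k

    ℕ→ℚ-1+j : ℕ→ℚ (suc j) ≡ 1ℚ + (iq + kq)
    ℕ→ℚ-1+j = trans (ℕ→ℚ-suc j) (cong (λ t → 1ℚ + t) ℕ→ℚ-j)

    ratio₀ : two * iq * B₀ ≡ (iq + kq) * B₀ + (1ℚ + (iq + kq)) * B₁
    ratio₀ = trans (cong (_* B₀) (sym (ℕ→ℚ-double i)))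
      (trans (binom-ratio N j) (cong₂ (λ u v → u * B₀ + v * B₁) ℕ→ℚ-j ℕ→ℚ-1+j))

    ratio₁ : two * iq * B₁ ≡ (1ℚ + (iq + kq)) * B₁ + (1ℚ + (1ℚ + (iq + kq))) * B₂
    ratio₁ = trans (cong (_* B₁) (sym (ℕ→ℚ-double i)))
      (trans (binom-ratio N (suc j))
             (cong₂ (λ u v → u * B₁ + v * B₂) ℕ→ℚ-1+j
                    (trans (ℕ→ℚ-suc (suc j)) (cong (λ t → 1ℚ + t) ℕ→ℚ-1+j))))

    T≡ : binom (2 ℕ.* suc i) (suc i ℕ.+ suc k) ≡ (B₀ + B₁) + (B₁ + B₂)
    T≡ = begin
      binom (2 ℕ.* suc i) (suc (i ℕ.+ suc k))
        ≡⟨ cong₂ binom (ℕP.*-suc 2 i) (cong suc (ℕP.+-suc i k)) ⟩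
      binom (suc (suc N)) (suc (suc j))
        ≡⟨ binom-pascal (suc N) (suc j) ⟩
      binom (suc N) (suc j) + binom (suc N) (suc (suc j))
        ≡⟨ cong₂ _+_ (binom-pascal N j) (binom-pascal N (suc j)) ⟩
      (B₀ + B₁) + (B₁ + B₂) ∎

    D≡ : two * ((1ℚ + iq) * (1ℚ + two * iq)) ≡ two * ℕ→ℚ (suc i ℕ.* suc N)
    D≡ = cong (two *_) (sym (trans (ℕ→ℚ-homo-* (suc i) (suc N))
      (cong₂ _*_ (ℕ→ℚ-suc i) (trans (ℕ→ℚ-suc N) (cong (λ t → 1ℚ + t) (ℕ→ℚ-double i))))))

    K≡ : ℕ→ℚ (suc k) ≡ 1ℚ + kq
    K≡ = ℕ→ℚ-suc k

    I≡ : ℕ→ℚ (suc i) ≡ 1ℚ + iq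
    I≡ = ℕ→ℚ-suc i

  binom-c₁≡ballot : binom (2 ℕ.* suc i) (suc i ℕ.+ suc k) * c₁ k i
                  ≡ two * ℕ→ℚ (suc i ℕ.* suc (2 ℕ.* i)) * ballot i k
  binom-c₁≡ballot = begin
    binom (2 ℕ.* suc i) (suc i ℕ.+ suc k) * c₁ k i
      ≡⟨ cong₂ _*_ T≡ (cong₂ (λ K I → (two * K - 1ℚ) * (I + K)) K≡ I≡) ⟩
    ((B₀ + B₁) + (B₁ + B₂)) * ((two * (1ℚ + kq) - 1ℚ) * ((1ℚ + iq) + (1ℚ + kq)))
      ≡⟨ ballot-coefficient₀ iq kq B₀ B₁ B₂ ratio₀ ratio₁ ⟩
    two * ((1ℚ + iq) * (1ℚ + two * iq)) * (B₀ - B₁)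
      ≡⟨ cong (_* (B₀ - B₁)) D≡ ⟩
    two * ℕ→ℚ (suc i ℕ.* suc N) * ballot i k ∎

  binom-c₂≡ballot : binom (2 ℕ.* suc i) (suc i ℕ.+ suc k) * c₂ k i
                  ≡ two * ℕ→ℚ (suc i ℕ.* suc (2 ℕ.* i)) * ballot i (suc k)
  binom-c₂≡ballot = begin
    binom (2 ℕ.* suc i) (suc i ℕ.+ suc k) * c₂ k i
      ≡⟨ cong₂ _*_ T≡ (cong₂ (λ K I → (two * K + 1ℚ) * (I - K)) K≡ I≡) ⟩
    ((B₀ + B₁) + (B₁ + B₂)) * ((two * (1ℚ + kq) + 1ℚ) * ((1ℚ + iq) - (1ℚ + kq)))
      ≡⟨ ballot-coefficient₁ iq kq B₀ B₁ B₂ ratio₀ ratio₁ ⟩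
    two * ((1ℚ + iq) * (1ℚ + two * iq)) * (B₁ - B₂)
      ≡⟨ cong₂ _*_ D≡ (cong (Δbinom N) (sym (ℕP.+-suc i k))) ⟩
    two * ℕ→ℚ (suc i ℕ.* suc N) * ballot i (suc k) ∎

x*g-coeff : ℕ → ℕ → ℚ
x*g-coeff k zero    = 0ℚ
x*g-coeff k (suc s) = binom (2 ℕ.* k ℕ.∸ s) s

x*g-coeff-absorption : ∀ k r → r ≤ suc k →
  ℕ→ℚ r * binom (2 ℕ.* suc k ℕ.∸ r) r ≡ ℕ→ℚ (suc k ℕ.+ (suc k ℕ.∸ r)) * x*g-coeff k r
x*g-coeff-absorption k zero _ =
  trans (ℚP.*-zeroˡ (binom (2 ℕ.* suc k) 0)) (sym (ℚP.*-zeroʳ (ℕ→ℚ (suc k ℕ.+ suc k))))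
x*g-coeff-absorption k (suc s) (s≤s s≤k) =
  subst₂ (λ a b → ℕ→ℚ (suc s) * binom a (suc s) ≡ ℕ→ℚ b * binom m s)
    (sym 2[1+k]∸[1+s]≡1+m) (sym [1+k]+[[1+k]∸[1+s]]≡1+m) (binom-absorption m s)
  where
  m = 2 ℕ.* k ℕ.∸ s
  s≤2k : s ≤ 2 ℕ.* k
  s≤2k = ℕP.≤-trans s≤k (ℕP.m≤m+n k (k ℕ.+ 0))
  2[1+k]∸[1+s]≡1+m : 2 ℕ.* suc k ℕ.∸ suc s ≡ suc m
  2[1+k]∸[1+s]≡1+m = trans (cong (ℕ._∸ suc s) (ℕP.*-suc 2 k)) (ℕP.+-∸-assoc 1 s≤2k)
  [1+k]+[[1+k]∸[1+s]]≡1+m : suc k ℕ.+ (suc k ℕ.∸ suc s) ≡ suc m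
  [1+k]+[[1+k]∸[1+s]]≡1+m =
    cong suc (trans (sym (ℕP.+-∸-assoc k s≤k))
                    (cong (λ t → (k ℕ.+ t) ℕ.∸ s) (sym (ℕP.+-identityʳ k))))

module _ (x : ℚ) where

  -- The summand of F (suc k) (suc i) x verbatim, so that F unfolds to a sumTo of it.
  F-term : ℕ → ℕ → ℕ → ℚ
  F-term k i r =
    ((+ 1) / (suc k ℕ.+ (suc k ℕ.∸ r))) * binom (2 ℕ.* suc k ℕ.∸ r) r
    * ( ℕ→ℚ r * Iq + ℕ→ℚ 2 * Iq * Kq * Kq - Iq * Kq
        - ℕ→ℚ 2 * ℕ→ℚ r * Kq * Kq + ℕ→ℚ 2 * Kq * Kq * Kq - Kq * Kq )
    * x ^ r
    where
    Kq Iq : ℚ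
    Kq = ℕ→ℚ (suc k)
    Iq = ℕ→ℚ (suc i)

  Σ<-x*g-coeff : ∀ k → Σ< (suc (suc k)) (λ r → x*g-coeff k r * x ^ r) ≡ x * g k x
  Σ<-x*g-coeff k = begin
    Σ< (suc (suc k)) (λ r → x*g-coeff k r * x ^ r)
      ≡⟨ Σ<-head (suc k) (λ r → x*g-coeff k r * x ^ r) ⟩
    0ℚ * 1ℚ + Σ< (suc k) (λ s → b s * (x * x ^ s))
      ≡⟨ ℚP.+-identityˡ _ ⟩
    Σ< (suc k) (λ s → b s * (x * x ^ s))
      ≡⟨ Σ<-cong (suc k) (λ s _ → solve 3 (λ a x p → a :* (x :* p) := x :* (a :* p)) refl (b s) x (x ^ s)) ⟩
    Σ< (suc k) (λ s → x * (b s * x ^ s))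
      ≡⟨ *-distribˡ-Σ< (suc k) x (λ s → b s * x ^ s) ⟩
    x * Σ< (suc k) (λ s → b s * x ^ s)
      ≡⟨ cong (x *_) (sumTo≡Σ< k (λ s → b s * x ^ s)) ⟨
    x * g k x ∎
    where
    b : ℕ → ℚ
    b s = binom (2 ℕ.* k ℕ.∸ s) s

  -- With K = k+1, the polynomial factor of the summand is (c₁ (2K-r) + c₂ r)/2, and
  -- absorption turns r C(2K-r,r) into (2K-r) C(2K-r-1,r-1), cancelling the denominator.
  F-term-split : ∀ k i r → r ≤ suc k →
    F-term k i r ≡ half * (c₁ k i * binom (2 ℕ.* suc k ℕ.∸ r) r + c₂ k i * x*g-coeff k r) * x ^ r
  F-term-split k i r r≤K = sym (begin
    half * (C₁ * α + C₂ * β) * xr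
      ≡⟨ ℚP.*-identityˡ _ ⟨
    1ℚ * (half * (C₁ * α + C₂ * β) * xr)
      ≡⟨ cong (_* (half * (C₁ * α + C₂ * β) * xr)) (1/[1+n]*[1+n]≡1 n) ⟨
    (ρ * nq) * (half * (C₁ * α + C₂ * β) * xr)
      ≡⟨ solve 8 (λ ρ nq h C₁ C₂ α β xr → (ρ :* nq) :* (h :* (C₁ :* α :+ C₂ :* β) :* xr)
                                        := ρ :* h :* (C₁ :* α :* nq :+ C₂ :* (nq :* β)) :* xr)
           refl ρ nq half C₁ C₂ α β xr ⟩
    ρ * half * (C₁ * α * nq + C₂ * (nq * β)) * xr
      ≡⟨ cong (λ u → ρ * half * (C₁ * α * nq + C₂ * u) * xr) (x*g-coeff-absorption k r r≤K) ⟨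
    ρ * half * (C₁ * α * nq + C₂ * (rq * α)) * xr
      ≡⟨ cong (λ u → ρ * half * (C₁ * α * u + C₂ * (rq * α)) * xr) nq≡2K-r ⟩
    ρ * half * (C₁ * α * (two * Kq - rq) + C₂ * (rq * α)) * xr
      ≡⟨ solve 6 (λ ρ α K I r xr →
           ρ :* con half :* (((con two :* K :- con 1ℚ) :* (I :+ K)) :* α :* (con two :* K :- r)
                             :+ ((con two :* K :+ con 1ℚ) :* (I :- K)) :* (r :* α)) :* xr
           := ρ :* α :* (r :* I :+ con two :* I :* K :* K :- I :* K
                         :- con two :* r :* K :* K :+ con two :* K :* K :* K :- K :* K) :* xr)
           refl ρ α Kq Iq rq xr ⟩
    F-term k i r ∎)
    where
    n = k ℕ.+ (suc k ℕ.∸ r)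
    ρ = (+ 1) / suc n
    nq = ℕ→ℚ (suc n)
    Kq = ℕ→ℚ (suc k)
    Iq = ℕ→ℚ (suc i)
    rq = ℕ→ℚ r
    xr = x ^ r
    α = binom (2 ℕ.* suc k ℕ.∸ r) r
    β = x*g-coeff k r
    C₁ = c₁ k i
    C₂ = c₂ k i
    nq≡2K-r : nq ≡ two * Kq - rq
    nq≡2K-r = trans (ℕ→ℚ-homo-+ (suc k) (suc k ℕ.∸ r))
      (trans (cong (λ t → Kq + t) (ℕ→ℚ-homo-∸ r≤K))
             (solve 2 (λ K r → K :+ (K :- r) := con two :* K :- r) refl Kq rq))

  F-sum : ∀ k i →
    sumTo (suc k) (F-term k i) ≡ half * (c₁ k i * g (suc k) x + c₂ k i * (x * g k x))
  F-sum k i = begin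
    sumTo (suc k) (F-term k i)
      ≡⟨ sumTo≡Σ< (suc k) (F-term k i) ⟩
    Σ< (suc (suc k)) (F-term k i)
      ≡⟨ Σ<-cong (suc (suc k))
           (λ r r<2+k → trans (F-term-split k i r (ℕP.≤-pred r<2+k)) (regroup r)) ⟩
    Σ< (suc (suc k)) (λ r → a * (α r * x ^ r) + b * (x*g-coeff k r * x ^ r))
      ≡⟨ Σ<-distrib-+ (suc (suc k)) (λ r → a * (α r * x ^ r)) (λ r → b * (x*g-coeff k r * x ^ r)) ⟩
    Σ< (suc (suc k)) (λ r → a * (α r * x ^ r))
      + Σ< (suc (suc k)) (λ r → b * (x*g-coeff k r * x ^ r))
      ≡⟨ cong₂ _+_ (*-distribˡ-Σ< (suc (suc k)) a (λ r → α r * x ^ r))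
                   (*-distribˡ-Σ< (suc (suc k)) b (λ r → x*g-coeff k r * x ^ r)) ⟩
    a * Σ< (suc (suc k)) (λ r → α r * x ^ r) + b * Σ< (suc (suc k)) (λ r → x*g-coeff k r * x ^ r)
      ≡⟨ cong₂ (λ u v → a * u + b * v)
           (sym (sumTo≡Σ< (suc k) (λ r → α r * x ^ r))) (Σ<-x*g-coeff k) ⟩
    a * g (suc k) x + b * (x * g k x)
      ≡⟨ solve 5 (λ h c d G H → h :* c :* G :+ h :* d :* H := h :* (c :* G :+ d :* H))
           refl half (c₁ k i) (c₂ k i) (g (suc k) x) (x * g k x) ⟩
    half * (c₁ k i * g (suc k) x + c₂ k i * (x * g k x)) ∎
    where
    a = half * c₁ k i
    b = half * c₂ k i
    α : ℕ → ℚ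
    α r = binom (2 ℕ.* suc k ℕ.∸ r) r
    regroup : ∀ r → half * (c₁ k i * α r + c₂ k i * x*g-coeff k r) * x ^ r
                  ≡ a * (α r * x ^ r) + b * (x*g-coeff k r * x ^ r)
    regroup r = solve 6
      (λ h c d u v p → h :* (c :* u :+ d :* v) :* p := h :* c :* (u :* p) :+ h :* d :* (v :* p))
      refl half (c₁ k i) (c₂ k i) (α r) (x*g-coeff k r) (x ^ r)

  F-closed-form : ∀ k i →
    F (suc k) (suc i) x ≡ ballot i k * g (suc k) x + x * ballot i (suc k) * g k x
  F-closed-form k i = begin
    F (suc k) (suc i) x
      ≡⟨ cong₂ (λ b s → ρ * ℕ→ℚ b * s) binomℤ≡ (F-sum k i) ⟩
    ρ * T * (half * (c₁ k i * G + c₂ k i * (x * H)))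
      ≡⟨ solve 7 (λ ρ T h c d G xH → ρ :* T :* (h :* (c :* G :+ d :* xH))
                                   := ρ :* h :* ((T :* c) :* G :+ (T :* d) :* xH))
           refl ρ T half (c₁ k i) (c₂ k i) G (x * H) ⟩
    ρ * half * ((T * c₁ k i) * G + (T * c₂ k i) * (x * H))
      ≡⟨ cong₂ (λ u v → ρ * half * (u * G + v * (x * H)))
           (binom-c₁≡ballot k i) (binom-c₂≡ballot k i) ⟩
    ρ * half * ((two * D * b₀) * G + (two * D * b₁) * (x * H))
      ≡⟨ solve 8 (λ ρ h D b₀ b₁ G x H →
                    ρ :* h :* ((con two :* D :* b₀) :* G :+ (con two :* D :* b₁) :* (x :* H))
                    := (ρ :* D) :* (h :* con two) :* (b₀ :* G :+ x :* b₁ :* H))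
           refl ρ half D b₀ b₁ G x H ⟩
    (ρ * D) * (half * two) * (b₀ * G + x * b₁ * H)
      ≡⟨ cong (λ u → u * (half * two) * (b₀ * G + x * b₁ * H)) ρ*D≡1 ⟩
    1ℚ * (half * two) * (b₀ * G + x * b₁ * H)
      ≡⟨ solve 1 (λ y → con 1ℚ :* (con half :* con two) :* y := y) refl (b₀ * G + x * b₁ * H) ⟩
    b₀ * G + x * b₁ * H ∎
    where
    ρ = (+ 1) / (suc i ℕ.* suc (2 ℕ.* i))
    D = ℕ→ℚ (suc i ℕ.* suc (2 ℕ.* i))
    T = binom (2 ℕ.* suc i) (suc i ℕ.+ suc k)
    G = g (suc k) x
    H = g k x
    b₀ = ballot i k
    b₁ = ballot i (suc k)
    binomℤ≡ : binomℤ (2 ℕ.* suc i) (+ suc i ℤ.- + suc k) ≡ (2 ℕ.* suc i) C (suc i ℕ.+ suc k)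
    binomℤ≡ = trans (cong (binomℤ (2 ℕ.* suc i)) (ℤP.m-n≡m⊖n (suc i) (suc k))) (binomℤ-⊖ (suc i) (suc k))
    -- suc i * suc (2 * i) unfolds to suc (2 * i + i * suc (2 * i)).
    ρ*D≡1 : ρ * D ≡ 1ℚ
    ρ*D≡1 = 1/[1+n]*[1+n]≡1 (2 ℕ.* i ℕ.+ i ℕ.* suc (2 ℕ.* i))

-- The LU decomposition

F-diag : (x : ℚ) (k : ℕ) → 1 ≤ k → F k k x ≡ g k x
F-diag x (suc k) _ = begin
  F (suc k) (suc k) x                                     ≡⟨ F-closed-form x k k ⟩
  ballot k k * g (suc k) x + x * ballot k (suc k) * g k x
    ≡⟨ cong₂ (λ u v → u * g (suc k) x + x * v * g k x) (ballot-diag k) (ballot-vanish (ℕP.n<1+n k)) ⟩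
  1ℚ * g (suc k) x + x * 0ℚ * g k x
    ≡⟨ solve 3 (λ G x H → con 1ℚ :* G :+ x :* con 0ℚ :* H := G) refl (g (suc k) x) x (g k x) ⟩
  g (suc k) x                                             ∎

F-above-diagonal : ∀ x {c a} → a < c → F (suc c) (suc a) x ≡ 0ℚ
F-above-diagonal x {c} {a} a<c = begin
  F (suc c) (suc a) x                                     ≡⟨ F-closed-form x c a ⟩
  ballot a c * g (suc c) x + x * ballot a (suc c) * g c x
    ≡⟨ cong₂ (λ u v → u * g (suc c) x + x * v * g c x)
         (ballot-vanish a<c) (ballot-vanish (ℕP.m<n⇒m<1+n a<c)) ⟩
  0ℚ * g (suc c) x + x * 0ℚ * g c x
    ≡⟨ solve 3 (λ G x H → con 0ℚ :* G :+ x :* con 0ℚ :* H := con 0ℚ) refl (g (suc c) x) x (g c x) ⟩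
  0ℚ                                                      ∎

-- One term of (LU)[a,b], with F in closed form: the first summand on the right
-- is the Hankel term, the second telescopes when summed over the middle index.
LU-term-split : ∀ x A₀ A₁ B₀ B₁ G₀ G₁ → G₀ ≢ 0ℚ → G₁ ≢ 0ℚ →
  (A₀ * G₁ + x * A₁ * G₀) * inv G₁ * ((B₀ * G₁ + x * B₁ * G₀) * inv G₀)
  ≡ (A₀ * B₀ + x * ((A₀ + A₁) * (B₀ + B₁)))
    + ((G₁ * inv G₀ - 1ℚ - x) * (A₀ * B₀) + (x * x * (G₀ * inv G₁) - x) * (A₁ * B₁))
LU-term-split x A₀ A₁ B₀ B₁ G₀ G₁ G₀≢0 G₁≢0 = begin
  (A₀ * G₁ + x * A₁ * G₀) * i₁ * ((B₀ * G₁ + x * B₁ * G₀) * i₀)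
    ≡⟨ solve 9 (λ A₀ A₁ B₀ B₁ G₀ G₁ i₀ i₁ x →
         (A₀ :* G₁ :+ x :* A₁ :* G₀) :* i₁ :* ((B₀ :* G₁ :+ x :* B₁ :* G₀) :* i₀)
         := A₀ :* B₀ :* G₁ :* i₀ :* (G₁ :* i₁) :+ x :* A₀ :* B₁ :* (G₁ :* i₁) :* (G₀ :* i₀)
            :+ x :* A₁ :* B₀ :* (G₁ :* i₁) :* (G₀ :* i₀) :+ x :* x :* A₁ :* B₁ :* G₀ :* i₁ :* (G₀ :* i₀))
         refl A₀ A₁ B₀ B₁ G₀ G₁ i₀ i₁ x ⟩
  expanded (G₁ * i₁) (G₀ * i₀)
    ≡⟨ cong₂ expanded (inv-inverseʳ G₁ G₁≢0) (inv-inverseʳ G₀ G₀≢0) ⟩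
  expanded 1ℚ 1ℚ
    ≡⟨ solve 9 (λ A₀ A₁ B₀ B₁ G₀ G₁ i₀ i₁ x →
         A₀ :* B₀ :* G₁ :* i₀ :* con 1ℚ :+ x :* A₀ :* B₁ :* con 1ℚ :* con 1ℚ
            :+ x :* A₁ :* B₀ :* con 1ℚ :* con 1ℚ :+ x :* x :* A₁ :* B₁ :* G₀ :* i₁ :* con 1ℚ
         := (A₀ :* B₀ :+ x :* ((A₀ :+ A₁) :* (B₀ :+ B₁)))
            :+ ((G₁ :* i₀ :- con 1ℚ :- x) :* (A₀ :* B₀) :+ (x :* x :* (G₀ :* i₁) :- x) :* (A₁ :* B₁)))
         refl A₀ A₁ B₀ B₁ G₀ G₁ i₀ i₁ x ⟩
  (A₀ * B₀ + x * ((A₀ + A₁) * (B₀ + B₁)))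
    + ((G₁ * i₀ - 1ℚ - x) * (A₀ * B₀) + (x * x * (G₀ * i₁) - x) * (A₁ * B₁)) ∎
  where
  i₀ = inv G₀
  i₁ = inv G₁
  expanded : ℚ → ℚ → ℚ
  expanded e₁ e₀ = A₀ * B₀ * G₁ * i₀ * e₁ + x * A₀ * B₁ * e₁ * e₀
                 + x * A₁ * B₀ * e₁ * e₀ + x * x * A₁ * B₁ * G₀ * i₁ * e₀

module _ (n : ℕ) (x : ℚ) (g≢0 : (k : ℕ) → k ≤ n → g k x ≢ 0ℚ) where

  private
    G : ℕ → ℚ
    G c = g c x

    α β : ℕ → ℚ
    α c = G (suc c) * inv (G c) - 1ℚ - x
    β c = x * x * (G c * inv (G (suc c))) - x

    -- g 0 x and inv (g 0 x) both compute to 1ℚ.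
    α-zero : α 0 ≡ 0ℚ
    α-zero = trans (cong (λ u → u * 1ℚ - 1ℚ - x) (g-one x))
      (solve 1 (λ x → (con 1ℚ :+ x) :* con 1ℚ :- con 1ℚ :- x := con 0ℚ) refl x)

    α-suc+β : ∀ c → suc c ≤ n → α (suc c) + β c ≡ 0ℚ
    α-suc+β c c<n = begin
      α (suc c) + β c
        ≡⟨ solve 5 (λ G₂ G₁ G₀ i₁ x → (G₂ :* i₁ :- con 1ℚ :- x) :+ (x :* x :* (G₀ :* i₁) :- x)
                                     := (G₂ :+ x :* x :* G₀) :* i₁ :- (con 1ℚ :+ (x :+ x)))
             refl (G (suc (suc c))) (G (suc c)) (G c) (inv (G (suc c))) x ⟩
      (G (suc (suc c)) + x * x * G c) * inv (G (suc c)) - (1ℚ + (x + x))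
        ≡⟨ cong (λ u → u * inv (G (suc c)) - (1ℚ + (x + x))) (g-rec x c) ⟩
      (1ℚ + (x + x)) * G (suc c) * inv (G (suc c)) - (1ℚ + (x + x))
        ≡⟨ cong (_- (1ℚ + (x + x))) (ℚP.*-assoc (1ℚ + (x + x)) (G (suc c)) (inv (G (suc c)))) ⟩
      (1ℚ + (x + x)) * (G (suc c) * inv (G (suc c))) - (1ℚ + (x + x))
        ≡⟨ cong (λ u → (1ℚ + (x + x)) * u - (1ℚ + (x + x)))
             (inv-inverseʳ (G (suc c)) (g≢0 (suc c) c<n)) ⟩
      (1ℚ + (x + x)) * 1ℚ - (1ℚ + (x + x))
        ≡⟨ solve 1 (λ a → a :* con 1ℚ :- a := con 0ℚ) refl (1ℚ + (x + x)) ⟩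
      0ℚ ∎

  Lmat-lower-unitriangular : LowerUnitriangular n (Lmat n x)
  Lmat-lower-unitriangular =
    (λ a c a<c → trans (cong (_* inv (G (suc (toℕ c)))) (F-above-diagonal x a<c))
                       (ℚP.*-zeroˡ (inv (G (suc (toℕ c)))))) ,
    (λ a → trans (cong (_* inv (G (suc (toℕ a)))) (F-diag x (suc (toℕ a)) (s≤s z≤n)))
                 (inv-inverseʳ (G (suc (toℕ a))) (g≢0 (suc (toℕ a)) (FinP.toℕ<n a))))

  Umat-upper-triangular : UpperTriangular n (Umat n x)
  Umat-upper-triangular c b b<c =
    trans (cong (_* inv (G (toℕ c))) (F-above-diagonal x b<c)) (ℚP.*-zeroˡ (inv (G (toℕ c))))

  Σ<-LU : ∀ a b → a < n →
    Σ< n (λ c → F (suc c) (suc a) x * inv (G (suc c)) * (F (suc c) (suc b) x * inv (G c)))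
    ≡ catalan (a ℕ.+ b) + x * catalan (suc (a ℕ.+ b))
  Σ<-LU a b a<n = begin
    Σ< n (λ c → F (suc c) (suc a) x * inv (G (suc c)) * (F (suc c) (suc b) x * inv (G c)))
      ≡⟨ Σ<-cong n term-split ⟩
    Σ< n (λ c → hankel-term c + correction c)
      ≡⟨ Σ<-distrib-+ n hankel-term correction ⟩
    Σ< n hankel-term + Σ< n correction
      ≡⟨ cong (λ t → Σ< n hankel-term + t) correction-vanishes ⟩
    Σ< n hankel-term + 0ℚ
      ≡⟨ ℚP.+-identityʳ _ ⟩
    Σ< n hankel-term
      ≡⟨ Σ<-distrib-+ n P (λ c → x * (ballot′ a c * ballot′ b c)) ⟩
    Σ< n P + Σ< n (λ c → x * (ballot′ a c * ballot′ b c))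
      ≡⟨ cong (λ t → Σ< n P + t) (*-distribˡ-Σ< n x (λ c → ballot′ a c * ballot′ b c)) ⟩
    Σ< n P + x * Σ< n (λ c → ballot′ a c * ballot′ b c)
      ≡⟨ cong₂ (λ u v → u + x * v) (Σ<-ballot*ballot n a b a<n) (Σ<-ballot′*ballot′ n a b a<n) ⟩
    catalan (a ℕ.+ b) + x * catalan (suc (a ℕ.+ b)) ∎
    where
    P hankel-term correction : ℕ → ℚ
    P c = ballot a c * ballot b c
    hankel-term c = P c + x * (ballot′ a c * ballot′ b c)
    correction c = α c * P c + β c * P (suc c)

    term-split : ∀ c → c < n →
      F (suc c) (suc a) x * inv (G (suc c)) * (F (suc c) (suc b) x * inv (G c))
      ≡ hankel-term c + correction c
    term-split c c<n = begin
      F (suc c) (suc a) x * inv (G (suc c)) * (F (suc c) (suc b) x * inv (G c))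
        ≡⟨ cong₂ (λ u v → u * inv (G (suc c)) * (v * inv (G c)))
             (F-closed-form x c a) (F-closed-form x c b) ⟩
      (ballot a c * G (suc c) + x * ballot a (suc c) * G c) * inv (G (suc c))
        * ((ballot b c * G (suc c) + x * ballot b (suc c) * G c) * inv (G c))
        ≡⟨ LU-term-split x (ballot a c) (ballot a (suc c)) (ballot b c) (ballot b (suc c))
             (G c) (G (suc c)) (g≢0 c (ℕP.<⇒≤ c<n)) (g≢0 (suc c) c<n) ⟩
      (P c + x * (addNext (ballot a) c * addNext (ballot b) c)) + correction c
        ≡⟨ cong₂ (λ u v → (P c + x * (u * v)) + correction c)
             (ballot′≡addNext-ballot a c) (ballot′≡addNext-ballot b c) ⟨
      hankel-term c + correction c ∎

    correction-vanishes : Σ< n correction ≡ 0ℚ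
    correction-vanishes = begin
      Σ< n correction
        ≡⟨ solve 2 (λ S a → S := S :+ a :* con 0ℚ) refl (Σ< n correction) (α n) ⟩
      Σ< n correction + α n * 0ℚ
        ≡⟨ cong (λ t → Σ< n correction + α n * t) Pn≡0 ⟨
      Σ< n correction + α n * P n
        ≡⟨ telescope α β P n α-zero α-suc+β ⟩
      0ℚ ∎
      where
      Pn≡0 : P n ≡ 0ℚ
      Pn≡0 = trans (cong (_* ballot b n) (ballot-vanish a<n)) (ℚP.*-zeroˡ (ballot b n))

  Lmat*Umat≡𝓜 : (a b : Fin n) → matMul n (Lmat n x) (Umat n x) a b ≡ 𝓜 n x a b
  Lmat*Umat≡𝓜 a b = trans (sumFin≡Σ< n _) (Σ<-LU (toℕ a) (toℕ b) (FinP.toℕ<n a))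

theorem1 : ((x : ℚ) (k : ℕ) → 1 ≤ k → F k k x ≡ g k x)
    × ((n : ℕ) → 1 ≤ n → (x : ℚ) → ((k : ℕ) → k ≤ n → g k x ≢ 0ℚ)
       → LowerUnitriangular n (Lmat n x)
         × UpperTriangular n (Umat n x)
         × ((a b : Fin n) → matMul n (Lmat n x) (Umat n x) a b ≡ 𝓜 n x a b))
theorem1 = F-diag , λ n _ x g≢0 →
  Lmat-lower-unitriangular n x g≢0 , Umat-upper-triangular n x g≢0 , Lmat*Umat≡𝓜 n x g≢0
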